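{- For any active growing binary tree with $n$ internal nodes, $2k$ anchors ($k\ge1$) and height $h$, we have \[ h\le n-k+1\le 2^{h-1}. \] Both inequalities are sharp: for every $h\ge1$ each of them is attained with equality by some active growing binary tree of height $h$.
   Context: Growing binary trees are plane (ordered) binary trees whose nodes are of three types: internal nodes, anchors (active leaves) and dead leaves. They are produced by the following growth process: at time $t=0$ the tree consists of a single anchor; at each time $t=1,2,\dots$, every anchor is simultaneously replaced either by a dead leaf or by an internal node with two anchors as children. A growing binary tree is any tree obtainable after finitely many steps of this process. It is active if it has at least one anchor. The height of a tree is the maximal distance from the root to a node (in an active growing tree, all anchors lie at depth equal to the height). -}

module Defs where

open import Data.Nat using (ℕ; zero; suc; _+_; _⊔_; _≤_)
open import Relation.Binary.Construct.Closure.ReflexiveTransitive using (Star)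

data Tree : Set where
  anchor : Tree
  dead   : Tree
  node   : Tree → Tree → Tree

-- One step of the growth process: every anchor is simultaneously replaced
-- by a dead leaf or by an internal node with two anchor children;
-- dead leaves and internal nodes are kept.
data Step : Tree → Tree → Set where
  anchor→dead : Step anchor dead
  anchor→node : Step anchor (node anchor anchor)
  dead→dead   : Step dead dead
  node→node   : ∀ {l l′ r r′} → Step l l′ → Step r r′ → Step (node l r) (node l′ r′)

Growing : Tree → Set
Growing t = Star Step anchor t

internals : Tree → ℕ
internals anchor     = 0
internals dead       = 0
internals (node l r) = suc (internals l + internals r)

anchors : Tree → ℕ
anchors anchor     = 1
anchors dead       = 0
anchors (node l r) = anchors l + anchors r

height : Tree → ℕ
height anchor     = 0
height dead       = 0
height (node l r) = suc (height l ⊔ height r)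

Active : Tree → Set
Active t = 1 ≤ anchors t

{-# OPTIONS --safe #-}
module Submission where

-- A tree grown in s steps has its anchors at depth s and its dead leaves at
-- depths 1, …, s.  Weigh each anchor 1 and each dead leaf 2.  Kraft's equality
-- (a leaf at depth δ accounts for 2^(s∸δ) of 2^s) bounds the total weight a + 2d
-- by 2^s.  Along a path to an anchor, each of the s subtrees hanging off the path
-- weighs at least 2, except the deepest one, which together with the anchor still
-- weighs at least 2; so a + 2d ≥ 2s.  With a = 2k and n + 1 = a + d these read
-- s ≤ k + d ≤ 2^(s∸1), which is the claim since n + 1 = (k + d) + k.  The
-- caterpillar attains the lower bound, the complete tree the upper one.

open import Defs
open import Data.Nat using (ℕ; _+_; _*_; _∸_; _^_; _≤_; _<_; zero; suc; z≤n; s≤s)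
open import Data.Nat.Properties
open import Data.Nat.Tactic.RingSolver using (solve-∀)
open import Data.Product using (Σ; ∃; _×_; _,_; proj₁; proj₂)
open import Data.Sum using (_⊎_; inj₁; inj₂)
open import Data.Empty using (⊥-elim)
open import Relation.Binary.PropositionalEquality
open import Relation.Binary.Construct.Closure.ReflexiveTransitive using (Star; ε; _◅_; _◅◅_)
open import Algebra.Properties.CommutativeSemigroup +-commutativeSemigroup using (interchange)

deads : Tree → ℕ
deads anchor     = 0
deads dead       = 1
deads (node l r) = deads l + deads r

weight : Tree → ℕ
weight anchor     = 1
weight dead       = 2
weight (node l r) = weight l + weight r

internals+1≡anchors+deads : ∀ t → internals t + 1 ≡ anchors t + deads t
internals+1≡anchors+deads anchor     = refl
internals+1≡anchors+deads dead       = refl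
internals+1≡anchors+deads (node l r) = begin
  suc (internals l + internals r) + 1           ≡⟨ +-suc (internals l + internals r) 1 ⟨
  (internals l + internals r) + (1 + 1)         ≡⟨ interchange (internals l) 1 (internals r) 1 ⟨
  (internals l + 1) + (internals r + 1)         ≡⟨ cong₂ _+_ (internals+1≡anchors+deads l) (internals+1≡anchors+deads r) ⟩
  (anchors l + deads l) + (anchors r + deads r) ≡⟨ interchange (anchors l) (deads l) (anchors r) (deads r) ⟩
  (anchors l + anchors r) + (deads l + deads r) ∎
  where open ≡-Reasoning

weight≡anchors+2*deads : ∀ t → weight t ≡ anchors t + 2 * deads t
weight≡anchors+2*deads anchor     = refl
weight≡anchors+2*deads dead       = refl
weight≡anchors+2*deads (node l r) = begin
  weight l + weight r                                   ≡⟨ cong₂ _+_ (weight≡anchors+2*deads l) (weight≡anchors+2*deads r) ⟩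
  (anchors l + 2 * deads l) + (anchors r + 2 * deads r) ≡⟨ interchange (anchors l) _ (anchors r) _ ⟩
  (anchors l + anchors r) + (2 * deads l + 2 * deads r) ≡⟨ cong (anchors l + anchors r +_) (*-distribˡ-+ 2 (deads l) (deads r)) ⟨
  (anchors l + anchors r) + 2 * (deads l + deads r)     ∎
  where open ≡-Reasoning

0<weight : ∀ t → 0 < weight t
0<weight anchor     = s≤s z≤n
0<weight dead       = s≤s z≤n
0<weight (node l r) = ≤-trans (0<weight l) (m≤m+n (weight l) (weight r))

active-node : ∀ l r → Active (node l r) → Active l ⊎ Active r
active-node l r act with anchors l
... | zero  = inj₂ act
... | suc _ = inj₁ (s≤s z≤n)

-- Grown s t: t is reached from a single anchor in exactly s steps.
data Grown : ℕ → Tree → Set where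
  anchor : Grown 0 anchor
  dead   : ∀ {s} → Grown (suc s) dead
  node   : ∀ {s l r} → Grown s l → Grown s r → Grown (suc s) (node l r)

Grown-step : ∀ {s t t′} → Grown s t → Step t t′ → Grown (suc s) t′
Grown-step anchor     anchor→dead      = dead
Grown-step anchor     anchor→node      = node anchor anchor
Grown-step dead       dead→dead        = dead
Grown-step (node l r) (node→node p q) = node (Grown-step l p) (Grown-step r q)

Grown-unstep : ∀ {s t} → Grown (suc s) t → Σ Tree λ t′ → Grown s t′ × Step t′ t
Grown-unstep {zero}  dead                 = anchor , anchor , anchor→dead
Grown-unstep {suc s} dead                 = dead , dead , dead→dead
Grown-unstep {zero}  (node anchor anchor) = anchor , anchor , anchor→node
Grown-unstep {suc s} (node l r) with Grown-unstep l | Grown-unstep r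
... | l′ , gl′ , l′→l | r′ , gr′ , r′→r = node l′ r′ , node gl′ gr′ , node→node l′→l r′→r

Grown-steps : ∀ {s t t′} → Grown s t → Star Step t t′ → ∃ λ s′ → Grown s′ t′
Grown-steps g ε        = _ , g
Grown-steps g (p ◅ ps) = Grown-steps (Grown-step g p) ps

Growing⇒Grown : ∀ {t} → Growing t → ∃ λ s → Grown s t
Growing⇒Grown = Grown-steps anchor

Grown⇒Growing : ∀ {s t} → Grown s t → Growing t
Grown⇒Growing {zero}  anchor = ε
Grown⇒Growing {suc s} g with Grown-unstep g
... | _ , g′ , t′→t = Grown⇒Growing g′ ◅◅ (t′→t ◅ ε)

height≤age : ∀ {s t} → Grown s t → height t ≤ s
height≤age anchor     = z≤n
height≤age dead       = z≤n
height≤age (node l r) = s≤s (⊔-lub (height≤age l) (height≤age r))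

age≤height : ∀ {s t} → Grown s t → Active t → s ≤ height t
age≤height anchor _  = z≤n
age≤height dead   ()
age≤height (node {l = l} {r} gl gr) act with active-node l r act
... | inj₁ al = s≤s (≤-trans (age≤height gl al) (m≤m⊔n (height l) (height r)))
... | inj₂ ar = s≤s (≤-trans (age≤height gr ar) (m≤n⊔m (height l) (height r)))

height≡age : ∀ {s t} → Grown s t → Active t → height t ≡ s
height≡age g act = ≤-antisym (height≤age g) (age≤height g act)

weight≤2^age : ∀ {s t} → Grown s t → weight t ≤ 2 ^ s
weight≤2^age anchor         = ≤-refl
weight≤2^age (dead {s})     = *-monoʳ-≤ 2 (m^n>0 2 s)
weight≤2^age (node {s} l r) =
  +-mono-≤ (weight≤2^age l) (≤-trans (weight≤2^age r) (m≤m+n (2 ^ s) 0))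

2≤weight : ∀ {s t} → Grown (suc s) t → 2 ≤ weight t
2≤weight dead                   = ≤-refl
2≤weight (node {l = l} {r} _ _) = +-mono-≤ (0<weight l) (0<weight r)

2*suc≤+ : ∀ s {a b} → 2 * s ≤ a → 2 ≤ b → 2 * suc s ≤ a + b
2*suc≤+ s {a} {b} 2s≤a 2≤b = begin
  2 * suc s ≡⟨ *-suc 2 s ⟩
  2 + 2 * s ≡⟨ +-comm 2 (2 * s) ⟩
  2 * s + 2 ≤⟨ +-mono-≤ 2s≤a 2≤b ⟩
  a + b     ∎
  where open ≤-Reasoning

2*age≤weight : ∀ {s t} → Grown s t → Active t → 2 * s ≤ weight t
2*age≤weight anchor               _ = z≤n
2*age≤weight (node anchor anchor) _ = ≤-refl
2*age≤weight (node {suc s} {l} {r} gl gr) act with active-node l r act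
... | inj₁ al = 2*suc≤+ (suc s) (2*age≤weight gl al) (2≤weight gr)
... | inj₂ ar = subst (2 * suc (suc s) ≤_) (+-comm (weight r) (weight l))
                  (2*suc≤+ (suc s) (2*age≤weight gr ar) (2≤weight gl))

grown-bounds : ∀ {s t k} → Grown (suc s) t → Active t → anchors t ≡ 2 * k →
               (suc s + k ≤ internals t + 1) × (internals t + 1 ≤ 2 ^ s + k)
grown-bounds {s} {t} {k} g act anchors≡2k =
  subst (suc s + k ≤_) (sym internals+1≡) (+-monoˡ-≤ k 1+s≤k+d) ,
  subst (_≤ 2 ^ s + k) (sym internals+1≡) (+-monoˡ-≤ k k+d≤2^s)
  where
  open ≡-Reasoning
  d = deads t

  2*m+n≡[m+n]+m : ∀ m n → 2 * m + n ≡ (m + n) + m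
  2*m+n≡[m+n]+m = solve-∀

  internals+1≡ : internals t + 1 ≡ (k + d) + k
  internals+1≡ = begin
    internals t + 1 ≡⟨ internals+1≡anchors+deads t ⟩
    anchors t + d   ≡⟨ cong (_+ d) anchors≡2k ⟩
    2 * k + d       ≡⟨ 2*m+n≡[m+n]+m k d ⟩
    (k + d) + k     ∎

  weight≡ : weight t ≡ 2 * (k + d)
  weight≡ = begin
    weight t          ≡⟨ weight≡anchors+2*deads t ⟩
    anchors t + 2 * d ≡⟨ cong (_+ 2 * d) anchors≡2k ⟩
    2 * k + 2 * d     ≡⟨ *-distribˡ-+ 2 k d ⟨
    2 * (k + d)       ∎

  1+s≤k+d : suc s ≤ k + d
  1+s≤k+d = *-cancelˡ-≤ 2 (subst (2 * suc s ≤_) weight≡ (2*age≤weight g act))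

  k+d≤2^s : k + d ≤ 2 ^ s
  k+d≤2^s = *-cancelˡ-≤ 2 (subst (_≤ 2 ^ suc s) weight≡ (weight≤2^age g))

attained : ∀ {h t} k (P : ℕ → Tree → ℕ → Set) → Grown h t → 1 ≤ k → anchors t ≡ 2 * k → P h t k →
           Σ Tree λ t → Σ ℕ λ k → Growing t × Active t × 1 ≤ k × anchors t ≡ 2 * k × height t ≡ h
             × P (height t) t k
attained {h} {t} k P g 1≤k anchors≡2k p =
  t , k , Grown⇒Growing g , act , 1≤k , anchors≡2k , height≡age g act ,
  subst (λ h′ → P h′ t k) (sym (height≡age g act)) p
  where
  act : Active t
  act = subst (1 ≤_) (sym anchors≡2k) (≤-trans 1≤k (m≤m+n k (k + 0)))

caterpillar : ℕ → Tree
caterpillar zero    = node anchor anchor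
caterpillar (suc h) = node (caterpillar h) dead

Grown-caterpillar : ∀ h → Grown (suc h) (caterpillar h)
Grown-caterpillar zero    = node anchor anchor
Grown-caterpillar (suc h) = node (Grown-caterpillar h) dead

anchors-caterpillar : ∀ h → anchors (caterpillar h) ≡ 2
anchors-caterpillar zero    = refl
anchors-caterpillar (suc h) = trans (+-identityʳ _) (anchors-caterpillar h)

internals-caterpillar : ∀ h → internals (caterpillar h) ≡ suc h
internals-caterpillar zero    = refl
internals-caterpillar (suc h) = cong suc (trans (+-identityʳ _) (internals-caterpillar h))

complete : ℕ → Tree
complete zero    = anchor
complete (suc h) = node (complete h) (complete h)

Grown-complete : ∀ h → Grown h (complete h)
Grown-complete zero    = anchor
Grown-complete (suc h) = node (Grown-complete h) (Grown-complete h)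

anchors-complete : ∀ h → anchors (complete h) ≡ 2 ^ h
anchors-complete zero    = refl
anchors-complete (suc h) =
  cong₂ _+_ (anchors-complete h) (trans (anchors-complete h) (sym (+-identityʳ _)))

deads-complete : ∀ h → deads (complete h) ≡ 0
deads-complete zero    = refl
deads-complete (suc h) = cong₂ _+_ (deads-complete h) (deads-complete h)

internals-complete : ∀ h → internals (complete h) + 1 ≡ 2 ^ h
internals-complete h = begin
  internals (complete h) + 1                     ≡⟨ internals+1≡anchors+deads (complete h) ⟩
  anchors (complete h) + deads (complete h)      ≡⟨ cong₂ _+_ (anchors-complete h) (deads-complete h) ⟩
  2 ^ h + 0                                      ≡⟨ +-identityʳ (2 ^ h) ⟩
  2 ^ h                                          ∎
  where open ≡-Reasoning

lemma4p1 : ((t : Tree) (k : ℕ) → Growing t → Active t → 1 ≤ k → anchors t ≡ 2 * k →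
               (height t + k ≤ internals t + 1) × (internals t + 1 ≤ 2 ^ (height t ∸ 1) + k))
             × ((h : ℕ) → 1 ≤ h →
               (Σ Tree λ t → Σ ℕ λ k → Growing t × Active t × 1 ≤ k × anchors t ≡ 2 * k × height t ≡ h
                  × height t + k ≡ internals t + 1)
               × (Σ Tree λ t → Σ ℕ λ k → Growing t × Active t × 1 ≤ k × anchors t ≡ 2 * k × height t ≡ h
                  × internals t + 1 ≡ 2 ^ (height t ∸ 1) + k))
lemma4p1 .proj₁ t k growing act 1≤k anchors≡2k with Growing⇒Grown growing
... | zero  , anchor = ⊥-elim (<-irrefl refl (subst (2 ≤_) (sym anchors≡2k) (*-monoʳ-≤ 2 1≤k)))
... | suc s , g rewrite height≡age g act = grown-bounds g act anchors≡2k
lemma4p1 .proj₂ (suc h) _ =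
  attained 1 (λ h t k → h + k ≡ internals t + 1) (Grown-caterpillar h) ≤-refl
    (anchors-caterpillar h) (cong (_+ 1) (sym (internals-caterpillar h))) ,
  attained (2 ^ h) (λ h t k → internals t + 1 ≡ 2 ^ (h ∸ 1) + k) (Grown-complete (suc h)) (m^n>0 2 h)
    (anchors-complete (suc h)) (trans (internals-complete (suc h)) (cong (2 ^ h +_) (+-identityʳ (2 ^ h))))
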